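{- Let $D_S=(N_S,A_S\cup H_S)$ be a partially time-expanded network satisfying (P1)–(P4), let $\bar x$ be a feasible solution of $\mathrm{UPR}(D_T)$ and $\hat x=\mu(\bar x)$. Let $v\in N$, $(v,t)\in N_S$ with $t<T$, $e=((v,t),(v,\mathtt{n_S}(v,t)))\in H_S$ and $f=((v,t),(v,t+1))\in H_T$. Then $$\sum_{k\in\mathcal{K}^2_{\hat x}(v)}\hat x^k_e\le\sum_{k\in\mathcal{K}^2_{\hat x}(v)}\bar x^k_f+U_e,\qquad U_e:=\sum_{(w,t')\in N^-_T(v,t)\cup N^-_S(v,t)}u_{wv}\,(\mathtt{m_S}(w,t')-1).$$
   Context: Base network: a directed graph $D=(N,A)$; each arc $vw\in A$ has a transit time $\tau_{vw}\in\mathbb{N}$ and a capacity $u_{vw}\in\mathbb{N}$; each node $v\in N$ has a storage capacity $b_v\in\mathbb{N}$. $\mathcal{K}$ is a finite set of packets; packet $k$ has origin $s_k$ and destination $t_k$. For $v\in N$ let $\mathcal{K}_v=\{k\in\mathcal{K}: s_k\ne v,\ t_k\ne v\}$. Fix $T\in\mathbb{N}$, $[T]=\{0,\dots,T\}$. Fully time-expanded network $D_T=(N_T,A_T\cup H_T)$: $N_T=\{(v,t):v\in N,t\in[T]\}$; movement arcs $A_T=\{((v,t),(w,t+\tau_{vw})): (v,t)\in N_T, vw\in A, t+\tau_{vw}\le T\}$; holdover arcs $H_T=\{((v,t),(v,t+1)): v\in N, 0\le t<T\}$. $\mathrm{UPR}(D_T)$ is the integer program with binary variables $x^k_e$ ($k\in\mathcal{K}$,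 $e\in A_T\cup H_T$) and variable $\bar T$: minimize $\bar T$ s.t. $t'x^k_e\le\bar T$ for all $k$, $e=((v,t),(w,t'))\in A_T$; $\sum_{e=((v,t),(w,t'))\in A_T,\,w=t_k}t'x^k_e\le\bar T$ for all $k$; flow conservation for each $k$ at each $(v,t)\in N_T$ (out minus in equals $1$ at $(s_k,0)$, $-1$ at $(t_k,T)$, $0$ otherwise); $\sum_k x^k_e\le u_{vw}$ for each copy $e\in A_T$ of $vw$; $\sum_{k\in\mathcal{K}_v}x^k_e\le b_v$ for each holdover arc $e$ at $v$. A feasible solution gives each packet $k$ a trajectory $Q_k$ (directed path) in $D_T$ from $(s_k,0)$ to $(t_k,T)$. Partially time-expanded network: $N_S\subseteq N_T$; $\mathtt{n_S}(v,t)=\min\{t'>t:(v,t')\in N_S\}$, $\mathtt{m_S}(v,t)=\mathtt{n_S}(v,t)-t$ (defined even if $(v,t)\notin N_S$); $H_S$ consists of the arcs $((v,t),(v,\mathtt{n_S}(v,t)))$ for $(v,t)\in N_S$, $t<T$; $A_S$ is a set of arcs $((v,t),(w,t'))$ with both ends in $N_S$ and $vw\in A$. Properties: (P1) $(s_k,0),(t_k,T)\in N_S$ for all $k$; (P2) each $((v,t),(w,t'))\in A_S$ has $t'\le t+\tau_{vw}$; (P3) for each $vw\in A$ and $(v,t)\in N_S$ with $t+\tau_{vw}\le T$, $A_S$ contains a copy of $vw$ starting at $(v,t)$; (P4) if $((v,t),(w,t'))\in A_S$ there is no $(w,t'')\in N_S$ with $t'<t''\le t+\tau_{vw}$. Incoming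 neighbours: $N^-_S(v,t)=\{(w,t'):((w,t'),(v,t))\in A_S\}$ and $N^-_T(v,t)=\{(w,t'):((w,t'),(v,t))\in A_T\}$. Map $\mu:A_T\to A_S$: $((v,\bar t),(w,\bar t'))\mapsto((v,\hat t),(w,\hat t'))$, $\hat t=\max\{t\le\bar t:(v,t)\in N_S\}$, $\hat t'=\max\{t\le\hat t+\tau_{vw}:(w,t)\in N_S\}$. For feasible $\bar x$, $\hat x=\mu(\bar x)$: for each $k$, $\hat x^k$ is the incidence vector of the trajectory in $D_S$ whose movement arcs are the $\mu$-images of the movement arcs of $Q_k$ in order, joined by holdover arcs of $H_S$. For a packet $k$ whose path visits $v$ immediately after node $u$, its movement arc from $u$ to $v$ in $\bar x$ departs $u$ at time $\bar t^{k,out}_u$, and its $\mu$-image departs $u$ at time $\hat t^{k,out}_u\le\bar t^{k,out}_u$. $\mathcal{K}(v)$ is the set of packets in $\mathcal{K}_v$ whose trajectory in $\bar x$ contains a timed copy of $v$; $\mathcal{K}^1_{\hat x}(v)=\{k\in\mathcal{K}(v):\hat t^{k,out}_u=\bar t^{k,out}_u\}$ and $\mathcal{K}^2_{\hat x}(v)=\{k\in\mathcal{K}(v):\hat t^{k,out}_u<\bar t^{k,out}_u\}$. -}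

module Defs where

open import Data.Nat using (ℕ; zero; suc; _+_; _*_; _∸_; _≤_; _<_; _<ᵇ_)
open import Data.Nat.Properties using (_≟_)
open import Data.Fin using (Fin; zero; suc)
open import Data.Fin.Properties using () renaming (_≟_ to _≟F_)
open import Data.Bool using (Bool; true; false; if_then_else_; _∧_; _∨_; not)
open import Data.Product using (Σ; _×_; _,_; ∃)
open import Data.List using (List; []; _∷_; _++_; map)
open import Data.Bool.ListAction using (any)
open import Data.List.Relation.Unary.Unique.Propositional using (Unique)
open import Data.List.Membership.Propositional using (_∈_)
open import Relation.Binary.PropositionalEquality using (_≡_; _≢_)
open import Relation.Nullary.Decidable using (⌊_⌋)
open import Data.Empty using (⊥)

ΣF : ∀ {m} → (Fin m → ℕ) → ℕ
ΣF {zero}  f = 0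
ΣF {suc m} f = f zero + ΣF (λ i → f (suc i))

Σ≤ : ℕ → (ℕ → ℕ) → ℕ
Σ≤ zero    f = f 0
Σ≤ (suc N) f = Σ≤ N f + f (suc N)

-- Base network D = (N, A) with N = Fin n; vw ∈ A iff arc v w ≡ true
-- (no parallel arcs: an arc is determined by its end nodes).

record Network : Set where
  field
    n     : ℕ
    arc   : Fin n → Fin n → Bool
    τ     : Fin n → Fin n → ℕ
    cap   : Fin n → Fin n → ℕ
    store : Fin n → ℕ

record Packets (D : Network) : Set where
  field
    K   : ℕ
    src : Fin K → Fin (Network.n D)
    dst : Fin K → Fin (Network.n D)

module _ (D : Network) (T : ℕ) where
  open Network D

  TNode : Set
  TNode = Fin n × ℕ

  data TArc : Set where
    mv : Fin n → ℕ → Fin n → TArc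
    hd : Fin n → ℕ → TArc

  tailT : TArc → TNode
  tailT (mv v t w) = v , t
  tailT (hd v t)   = v , t

  headT : TArc → TNode
  headT (mv v t w) = w , t + τ v w
  headT (hd v t)   = v , suc t

  ValidT : TArc → Set
  ValidT (mv v t w) = arc v w ≡ true × t + τ v w ≤ T
  ValidT (hd v t)   = t < T

  data Walk (p : TNode) : TNode → List TArc → Set where
    nil  : Walk p p []
    cons : ∀ {q a as} → ValidT a → tailT a ≡ p → Walk (headT a) q as → Walk p q (a ∷ as)

  IsTrajectory : Fin n → Fin n → List TArc → Set
  IsTrajectory s d Q = Walk (s , 0) (d , T) Q × Unique ((s , 0) ∷ map headT Q)

  eqTᵇ : TArc → TArc → Bool
  eqTᵇ (mv v t w) (mv v' t' w') = ⌊ v ≟F v' ⌋ ∧ ⌊ t ≟ t' ⌋ ∧ ⌊ w ≟F w' ⌋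
  eqTᵇ (mv _ _ _) (hd _ _)      = false
  eqTᵇ (hd _ _)   (mv _ _ _)    = false
  eqTᵇ (hd v t)   (hd v' t')    = ⌊ v ≟F v' ⌋ ∧ ⌊ t ≟ t' ⌋

  incT : List TArc → TArc → ℕ
  incT Q a = if any (eqTᵇ a) Q then 1 else 0

  module _ (P : Packets D) where
    open Packets P

    inKv : Fin K → Fin n → Bool
    inKv k v = not ⌊ src k ≟F v ⌋ ∧ not ⌊ dst k ≟F v ⌋

    -- Feasible solution of UPR(D_T), given by the trajectories Q k of the
    -- packets (x̄^k = incidence vector of Q k).  The constraints involving
    -- the objective variable T̄ are always satisfiable (take T̄ = T).
    Feasible : (Fin K → List TArc) → Set
    Feasible Q =
        (∀ k → IsTrajectory (src k) (dst k) (Q k))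
      × (∀ v t w → ValidT (mv v t w) →
           ΣF (λ k → incT (Q k) (mv v t w)) ≤ cap v w)
      × (∀ v t → ValidT (hd v t) →
           ΣF (λ k → if inKv k v then incT (Q k) (hd v t) else 0) ≤ store v)

    record PTEN : Set where
      field
        NS : Fin n → ℕ → Bool
        AS : Fin n → ℕ → Fin n → ℕ → Bool
        NS⊆NT : ∀ v t → NS v t ≡ true → t ≤ T
        AS-arc : ∀ v t w t' → AS v t w t' ≡ true →
                   arc v w ≡ true × NS v t ≡ true × NS w t' ≡ true
        P1 : ∀ k → NS (src k) 0 ≡ true × NS (dst k) T ≡ true
        P2 : ∀ v t w t' → AS v t w t' ≡ true → t' ≤ t + τ v w
        P3 : ∀ v w t → arc v w ≡ true → NS v t ≡ true → t + τ v w ≤ T →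
               ∃ λ t' → AS v t w t' ≡ true
        P4 : ∀ v t w t' → AS v t w t' ≡ true →
               ∀ t'' → NS w t'' ≡ true → t' < t'' → t'' ≤ t + τ v w → ⊥

    module _ (S : PTEN) where
      open PTEN S

      -- max{ s ≤ t : (v,s) ∈ N_S }   (0 if no such s)
      lastNS : Fin n → ℕ → ℕ
      lastNS v zero    = 0
      lastNS v (suc t) = if NS v (suc t) then suc t else lastNS v t

      searchNS : Fin n → ℕ → ℕ → ℕ
      searchNS v zero    s = s
      searchNS v (suc f) s = if NS v s then s else searchNS v f (suc s)

      -- n_S(v,t) = min{ t' > t : (v,t') ∈ N_S }   (T+1 if no such t' exists)
      nS : Fin n → ℕ → ℕ
      nS v t = searchNS v (T ∸ t) (suc t)

      mS : Fin n → ℕ → ℕ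
      mS v t = nS v t ∸ t

      -- arcs of D_S:  smv v t w t' = ((v,t),(w,t')) ∈ A_S,
      --               shd v t      = ((v,t),(v,n_S(v,t))) ∈ H_S
      data SArc : Set where
        smv : Fin n → ℕ → Fin n → ℕ → SArc
        shd : Fin n → ℕ → SArc

      movements : List TArc → List (Fin n × ℕ × Fin n)
      movements []              = []
      movements (mv v t w ∷ as) = (v , t , w) ∷ movements as
      movements (hd v t ∷ as)   = movements as

      μ : Fin n × ℕ × Fin n → SArc
      μ (v , tb , w) = smv v (lastNS v tb) w (lastNS w (lastNS v tb + τ v w))

      chainF : ℕ → Fin n → ℕ → ℕ → List SArc
      chainF zero    v a b = []
      chainF (suc f) v a b = if a <ᵇ b then shd v a ∷ chainF f v (nS v a) b else []

      chain : Fin n → ℕ → ℕ → List SArc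
      chain = chainF (suc T)

      -- D_S trajectory starting at (c,a): μ-images of the movement arcs in
      -- order, joined by holdover arcs of H_S, ending at time T
      sTraj : Fin n → ℕ → List (Fin n × ℕ × Fin n) → List SArc
      sTraj c a []                 = chain c a T
      sTraj c a ((v , tb , w) ∷ ms) =
        chain c a (lastNS v tb) ++ (μ (v , tb , w) ∷ sTraj w (lastNS w (lastNS v tb + τ v w)) ms)

      isShd : Fin n → ℕ → SArc → Bool
      isShd v t (smv _ _ _ _) = false
      isShd v t (shd v' t')   = ⌊ v ≟F v' ⌋ ∧ ⌊ t ≟ t' ⌋

      module _ (Q : Fin K → List TArc) where

        x̂ : Fin K → Fin n → ℕ → ℕ
        x̂ k v t = if any (isShd v t) (sTraj (src k) 0 (movements (Q k))) then 1 else 0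

        x̄ : Fin K → Fin n → ℕ → ℕ
        x̄ k v t = incT (Q k) (hd v t)

        -- the movement arc of Q k from u into v departs u at t̄ (the copy of
        -- the predecessor u of v on the packet's path) and its μ-image departs
        -- earlier:  t̂^{k,out}_u = lastNS u t̄ < t̄
        entersEarly : Fin n → TArc → Bool
        entersEarly v (mv u tb w) = ⌊ w ≟F v ⌋ ∧ (lastNS u tb <ᵇ tb)
        entersEarly v (hd _ _)    = false

        inK2 : Fin K → Fin n → Bool
        inK2 k v = inKv k v ∧ any (entersEarly v) (Q k)

        -- each packet of K_v enters v (at most) once, so that its
        -- predecessor u of v is well defined
        SingleEntry : Fin n → Set
        SingleEntry v = ∀ k → inKv k v ≡ true →
          ∀ u₁ t₁ u₂ t₂ → mv u₁ t₁ v ∈ Q k → mv u₂ t₂ v ∈ Q k → u₁ ≡ u₂ × t₁ ≡ t₂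

      inNminus : Fin n → ℕ → Fin n → ℕ → Bool
      inNminus v t w t' = (arc w v ∧ ⌊ t' + τ w v ≟ t ⌋) ∨ AS w t' v t

      U : Fin n → ℕ → ℕ
      U v t = ΣF (λ w → Σ≤ T (λ t' →
                if inNminus v t w t' then cap w v * (mS w t' ∸ 1) else 0))

{-# OPTIONS --safe #-}
-- Fix a packet k ∈ K² whose μ-image holds over on e = ((v,t),(v,n_S(v,t))) while its own
-- trajectory does not use f = ((v,t),(v,t+1)).  Since k does not start at v, its trajectory
-- enters v by an arc (x,tb) → v arriving after t, whose μ-image departs at t̂ < tb and reaches
-- v by time t.  Either that image is the A_S copy of xv from (x,t̂), which by (P4) lands exactly
-- at (v,t), or (x,t − τ_xv) ∈ N⁻_T(v,t); in both cases tb lies strictly between t′ and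
-- n_S(x,t′) for some (x,t′) ∈ N⁻_T(v,t) ∪ N⁻_S(v,t).  Charging k to that copy of xv and using
-- the capacity u_xv for each of the m_S(x,t′) − 1 departure times in the window gives U_e.
module Submission where

open import Defs
open import Data.Bool using (Bool; true; false; if_then_else_; _∧_; not)
open import Data.Bool.Properties using (T-≡; ∨-zeroʳ)
open import Data.Bool.ListAction using (any)
open import Data.Empty using (⊥-elim)
open import Data.Fin using (Fin; zero; suc; toℕ; fromℕ<)
open import Data.Fin.Properties using (toℕ-fromℕ<) renaming (_≟_ to _≟F_)
open import Data.List using (List)
open import Data.List.Membership.Propositional using (_∈_; find; lose)
open import Data.List.Membership.Propositional.Properties using (∈-++⁻)
open import Data.List.Relation.Unary.Any using (here; there)
open import Data.List.Relation.Unary.Any.Properties using (any⁺; any⁻)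
open import Data.Nat using (ℕ; zero; suc; _+_; _*_; _∸_; _≤_; _<_; _<ᵇ_; z≤n; s≤s)
open import Data.Nat.Properties
open import Algebra.Properties.CommutativeMonoid.Sum +-0-commutativeMonoid using (sum; ∑-distrib-+)
open import Data.Product using (Σ; ∃; _×_; _,_; proj₁; proj₂)
open import Data.Sum using (_⊎_; inj₁; inj₂; map₁)
open import Function.Bundles using (Equivalence)
open import Relation.Binary.PropositionalEquality
open import Relation.Nullary using (Dec; yes; no; ¬_; contradiction)
open import Relation.Nullary.Decidable using (⌊_⌋)

toWitness′ : ∀ {A : Set} (d : Dec A) → ⌊ d ⌋ ≡ true → A
toWitness′ (yes a) _ = a

fromWitness′ : ∀ {A : Set} (d : Dec A) → A → ⌊ d ⌋ ≡ true
fromWitness′ (yes _) _ = refl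
fromWitness′ (no ¬a) a = contradiction a ¬a

toWitnessFalse′ : ∀ {A : Set} (d : Dec A) → not ⌊ d ⌋ ≡ true → ¬ A
toWitnessFalse′ (no ¬a) _ = ¬a

∧-true⁻ : ∀ {a b} → a ∧ b ≡ true → a ≡ true × b ≡ true
∧-true⁻ {true} {true} _ = refl , refl

<ᵇ-true⇒< : ∀ {m n} → (m <ᵇ n) ≡ true → m < n
<ᵇ-true⇒< {m} {n} e = <ᵇ⇒< m n (Equivalence.from T-≡ e)

any⇒∃∈ : ∀ {A : Set} (p : A → Bool) xs → any p xs ≡ true → ∃ λ x → x ∈ xs × p x ≡ true
any⇒∃∈ p xs e with x , x∈xs , px ← find (any⁻ p xs (Equivalence.from T-≡ e)) =
  x , x∈xs , Equivalence.to T-≡ px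

∈⇒any : ∀ {A : Set} (p : A → Bool) {x xs} → x ∈ xs → p x ≡ true → any p xs ≡ true
∈⇒any p x∈xs px = Equivalence.to T-≡ (any⁺ p (lose x∈xs (Equivalence.from T-≡ px)))

indicator≤ : ∀ b {m} → (b ≡ true → 1 ≤ m) → (if b then 1 else 0) ≤ m
indicator≤ false _ = z≤n
indicator≤ true  h = h refl

ΣF≡sum : ∀ {m} (f : Fin m → ℕ) → ΣF f ≡ sum f
ΣF≡sum {zero}  f = refl
ΣF≡sum {suc m} f = cong (f zero +_) (ΣF≡sum (λ i → f (suc i)))

ΣF-+ : ∀ {m} (f g : Fin m → ℕ) → ΣF (λ i → f i + g i) ≡ ΣF f + ΣF g
ΣF-+ f g = begin
  ΣF (λ i → f i + g i)  ≡⟨ ΣF≡sum (λ i → f i + g i) ⟩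
  sum (λ i → f i + g i) ≡⟨ ∑-distrib-+ f g ⟩
  sum f + sum g         ≡⟨ cong₂ _+_ (ΣF≡sum f) (ΣF≡sum g) ⟨
  ΣF f + ΣF g           ∎
  where open ≡-Reasoning

ΣF-const : ∀ {m} c → ΣF {m} (λ _ → c) ≡ c * m
ΣF-const {zero}  c = sym (*-zeroʳ c)
ΣF-const {suc m} c = trans (cong (c +_) (ΣF-const c)) (sym (*-suc c m))

ΣF-comm : ∀ {m m′} (f : Fin m → Fin m′ → ℕ) →
          ΣF (λ i → ΣF (f i)) ≡ ΣF (λ j → ΣF (λ i → f i j))
ΣF-comm {m} {zero}    f = ΣF-const {m} 0
ΣF-comm {m} {suc m′}  f =
  trans (ΣF-+ (λ i → f i zero) (λ i → ΣF (λ j → f i (suc j))))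
        (cong (ΣF (λ i → f i zero) +_) (ΣF-comm (λ i j → f i (suc j))))

ΣF-mono : ∀ {m} {f g : Fin m → ℕ} → (∀ i → f i ≤ g i) → ΣF f ≤ ΣF g
ΣF-mono {zero}  f≤g = z≤n
ΣF-mono {suc m} f≤g = +-mono-≤ (f≤g zero) (ΣF-mono (λ i → f≤g (suc i)))

term≤ΣF : ∀ {m} (f : Fin m → ℕ) i → f i ≤ ΣF f
term≤ΣF f zero    = m≤m+n _ _
term≤ΣF f (suc i) = ≤-trans (term≤ΣF (λ j → f (suc j)) i) (m≤n+m _ (f zero))

ΣF-positive : ∀ {m} (f : Fin m → ℕ) → 0 < ΣF f → ∃ λ i → 0 < f i
ΣF-positive {suc m} f ΣF>0 with f zero in eq
... | suc _ = zero , subst (0 <_) (sym eq) (s≤s z≤n)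
... | zero  with i , fi>0 ← ΣF-positive (λ j → f (suc j)) ΣF>0 = suc i , fi>0

ΣF-≤-if-positive : ∀ {m} (f : Fin m → ℕ) c → (∀ i → 0 < f i → ΣF f ≤ c) → ΣF f ≤ c
ΣF-≤-if-positive f c h with ΣF f in eq
... | zero  = z≤n
... | suc _ with i , fi>0 ← ΣF-positive f (subst (0 <_) (sym eq) (s≤s z≤n)) = h i fi>0

Σ≤-mono : ∀ N {f g : ℕ → ℕ} → (∀ i → f i ≤ g i) → Σ≤ N f ≤ Σ≤ N g
Σ≤-mono zero    f≤g = f≤g 0
Σ≤-mono (suc N) f≤g = +-mono-≤ (Σ≤-mono N f≤g) (f≤g (suc N))

term≤Σ≤ : ∀ N (f : ℕ → ℕ) {i} → i ≤ N → f i ≤ Σ≤ N f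
term≤Σ≤ zero    f z≤n = ≤-refl
term≤Σ≤ (suc N) f i≤ with m≤n⇒m<n∨m≡n i≤
... | inj₁ i<1+N = ≤-trans (term≤Σ≤ N f (m<1+n⇒m≤n i<1+N)) (m≤m+n _ _)
... | inj₂ refl  = m≤n+m _ _

ΣF-Σ≤ : ∀ {m} N (f : Fin m → ℕ → ℕ) → ΣF (λ k → Σ≤ N (f k)) ≡ Σ≤ N (λ s → ΣF (λ k → f k s))
ΣF-Σ≤ zero    f = refl
ΣF-Σ≤ (suc N) f =
  trans (ΣF-+ (λ k → Σ≤ N (f k)) (λ k → f k (suc N)))
        (cong (_+ ΣF (λ k → f k (suc N))) (ΣF-Σ≤ N f))

module _ (D : Network) (T : ℕ) where
  open Network D

  eqTᵇ-refl : ∀ a → eqTᵇ D T a a ≡ true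
  eqTᵇ-refl (mv v t w)
    rewrite fromWitness′ (v ≟F v) refl | fromWitness′ (t ≟ t) refl | fromWitness′ (w ≟F w) refl = refl
  eqTᵇ-refl (hd v t)
    rewrite fromWitness′ (v ≟F v) refl | fromWitness′ (t ≟ t) refl = refl

  eqTᵇ⇒≡ : ∀ a b → eqTᵇ D T a b ≡ true → a ≡ b
  eqTᵇ⇒≡ (mv v t w) (mv v′ t′ w′) e
    with v≡ , e′ ← ∧-true⁻ e
    with t≡ , w≡ ← ∧-true⁻ e′
    with refl ← toWitness′ (v ≟F v′) v≡ | refl ← toWitness′ (t ≟ t′) t≡ | refl ← toWitness′ (w ≟F w′) w≡
    = refl
  eqTᵇ⇒≡ (hd v t) (hd v′ t′) e
    with v≡ , t≡ ← ∧-true⁻ e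
    with refl ← toWitness′ (v ≟F v′) v≡ | refl ← toWitness′ (t ≟ t′) t≡
    = refl

  incT-∈ : ∀ {Q a} → a ∈ Q → incT D T Q a ≡ 1
  incT-∈ {a = a} a∈Q rewrite ∈⇒any (eqTᵇ D T a) a∈Q (eqTᵇ-refl a) = refl

  incT>0⇒∈ : ∀ Q a → 0 < incT D T Q a → a ∈ Q
  incT>0⇒∈ Q a used with any (eqTᵇ D T a) Q in e
  ... | true with b , b∈Q , a≡b ← any⇒∃∈ (eqTᵇ D T a) Q e = subst (_∈ Q) (sym (eqTᵇ⇒≡ a b a≡b)) b∈Q

  Walk-valid : ∀ {p q as a} → Walk D T p q as → a ∈ as → ValidT D T a
  Walk-valid (cons valid _ _) (here refl)  = valid
  Walk-valid (cons _ _ walk)  (there a∈as) = Walk-valid walk a∈as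

  module _ (P : Packets D) (S : PTEN D T P) where
    open Packets P
    open PTEN S

    lastS : Fin n → ℕ → ℕ
    lastS = lastNS D T P S

    nextS : Fin n → ℕ → ℕ
    nextS = nS D T P S

    lastS-≤ : ∀ v a → lastS v a ≤ a
    lastS-≤ v zero    = z≤n
    lastS-≤ v (suc a) with NS v (suc a)
    ... | true  = ≤-refl
    ... | false = m≤n⇒m≤1+n (lastS-≤ v a)

    ≤-lastS : ∀ v {s} a → NS v s ≡ true → s ≤ a → s ≤ lastS v a
    ≤-lastS v zero    _  s≤0 = s≤0
    ≤-lastS v (suc a) NS-s s≤ with NS v (suc a) in eq | m≤n⇒m<n∨m≡n s≤
    ... | true  | _              = s≤
    ... | false | inj₁ (s≤s s≤a) = ≤-lastS v a NS-s s≤a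
    ... | false | inj₂ refl      = contradiction (trans (sym NS-s) eq) λ ()

    NS-lastS : ∀ v {s} a → NS v s ≡ true → s ≤ a → NS v (lastS v a) ≡ true
    NS-lastS v zero    NS-s z≤n = NS-s
    NS-lastS v (suc a) NS-s s≤ with NS v (suc a) in eq | m≤n⇒m<n∨m≡n s≤
    ... | true  | _              = eq
    ... | false | inj₁ (s≤s s≤a) = NS-lastS v a NS-s s≤a
    ... | false | inj₂ refl      = contradiction (trans (sym NS-s) eq) λ ()

    searchNS-≥ : ∀ v f s → s ≤ searchNS D T P S v f s
    searchNS-≥ v zero    s = ≤-refl
    searchNS-≥ v (suc f) s with NS v s
    ... | true  = ≤-refl
    ... | false = ≤-trans (n≤1+n s) (searchNS-≥ v f (suc s))

    searchNS-skips : ∀ v f s a → (∀ s′ → s ≤ s′ → s′ ≤ a → NS v s′ ≡ false) → a < s + f →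
                     a < searchNS D T P S v f s
    searchNS-skips v zero    s a skipped a< = subst (a <_) (+-identityʳ s) a<
    searchNS-skips v (suc f) s a skipped a< with NS v s in eq | s ≤? a
    ... | true  | yes s≤a = contradiction (trans (sym eq) (skipped s ≤-refl s≤a)) λ ()
    ... | true  | no  s≰a = ≰⇒> s≰a
    ... | false | _       =
      searchNS-skips v f (suc s) a (λ s′ s<s′ → skipped s′ (≤-trans (n≤1+n s) s<s′))
        (subst (a <_) (+-suc s f) a<)

    <-nextS : ∀ v s → s < nextS v s
    <-nextS v s = searchNS-≥ v (T ∸ s) (suc s)

    lastS≤⇒<nextS : ∀ x {s tb} → lastS x tb ≤ s → tb ≤ T → tb < nextS x s
    lastS≤⇒<nextS x {s} {tb} last≤s tb≤T =
      searchNS-skips x (T ∸ s) (suc s) tb skipped (s≤s (≤-trans tb≤T (m≤n+m∸n T s)))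
      where
      skipped : ∀ s′ → s < s′ → s′ ≤ tb → NS x s′ ≡ false
      skipped s′ s<s′ s′≤tb with NS x s′ in eq
      ... | false = refl
      ... | true  = contradiction (≤-trans (≤-lastS x tb eq s′≤tb) last≤s) (<⇒≱ s<s′)

    chainF-shd : ∀ f c a b {v t} → shd v t ∈ chainF D T P S f c a b → v ≡ c × a ≤ t × t < b
    chainF-shd (suc f) c a b shd∈ with a <ᵇ b in a<b
    chainF-shd (suc f) c a b (here refl)  | true = refl , ≤-refl , <ᵇ-true⇒< a<b
    chainF-shd (suc f) c a b (there shd∈) | true
      with v≡c , next≤t , t<b ← chainF-shd f c (nextS c a) b shd∈ =
      v≡c , <⇒≤ (<-≤-trans (<-nextS c a) next≤t) , t<b

    isShd⇒≡ : ∀ {v t} y → isShd D T P S v t y ≡ true → y ≡ shd v t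
    isShd⇒≡ {v} {t} (shd v′ t′) e
      with v≡ , t≡ ← ∧-true⁻ e
      with refl ← toWitness′ (v ≟F v′) v≡ | refl ← toWitness′ (t ≟ t′) t≡
      = refl

    Walk-anchored : ∀ {c s q as} → Walk D T (c , s) q as → NS c (lastS c s) ≡ true →
                    ∀ {x tb y} → mv x tb y ∈ as → NS x (lastS x tb) ≡ true
    Walk-anchored (cons {a = mv _ _ _} _ refl _) anchor (here refl) = anchor
    Walk-anchored {c} {s} (cons {a = mv _ _ w} (c→w , s+τ≤T) refl walk) anchor (there mv∈)
      with last+τ≤s+τ ← +-monoˡ-≤ (τ c w) (lastS-≤ c s)
      with t″ , copy ← P3 c w (lastS c s) c→w anchor (≤-trans last+τ≤s+τ s+τ≤T)
      = Walk-anchored walk (NS-lastS w (s + τ c w) (proj₂ (proj₂ (AS-arc c (lastS c s) w t″ copy)))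
                             (≤-trans (P2 c (lastS c s) w t″ copy) last+τ≤s+τ)) mv∈
    Walk-anchored {c} {s} (cons {a = hd _ _} _ refl walk) anchor (there mv∈) =
      Walk-anchored walk (NS-lastS c (suc s) anchor (m≤n⇒m≤1+n (lastS-≤ c s))) mv∈

    -- A holdover ((v,t),(v,n_S(v,t))) on the μ-image of a walk that starts at (c,s) and whose
    -- image starts at (c,ŝ) comes either from the initial waiting at c, or from waiting after
    -- the image of an arc (x,tb) → v has reached v; either way the walk itself holds over
    -- at (v,t) or reaches v only after time t.
    data HoldoverCause (v : Fin n) (t : ℕ) (c : Fin n) (ŝ s : ℕ) (as : List (TArc D T)) : Set where
      initial : c ≡ v → ŝ ≤ t → hd v t ∈ as ⊎ t < s → HoldoverCause v t c ŝ s as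
      entered : ∀ x tb → mv x tb v ∈ as → lastS v (lastS x tb + τ x v) ≤ t →
                hd v t ∈ as ⊎ t < tb + τ x v → HoldoverCause v t c ŝ s as

    holdoverCause : ∀ {c s d as} ŝ {v t} → Walk D T (c , s) (d , T) as →
                    shd v t ∈ sTraj D T P S c ŝ (movements D T P S as) → HoldoverCause v t c ŝ s as
    holdoverCause {c} ŝ nil shd∈
      with refl , ŝ≤t , t<T ← chainF-shd (suc T) c ŝ T shd∈ = initial refl ŝ≤t (inj₂ t<T)
    holdoverCause ŝ (cons {a = hd _ _} _ refl walk) shd∈ with holdoverCause ŝ walk shd∈
    ... | initial refl ŝ≤t (inj₁ hd∈) = initial refl ŝ≤t (inj₁ (there hd∈))
    ... | initial refl ŝ≤t (inj₂ t<1+s) with m<1+n⇒m<n∨m≡n t<1+s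
    ...   | inj₁ t<s  = initial refl ŝ≤t (inj₂ t<s)
    ...   | inj₂ refl = initial refl ŝ≤t (inj₁ (here refl))
    holdoverCause ŝ (cons {a = hd _ _} _ refl walk) shd∈ | entered x tb mv∈ arrival≤t r =
      entered x tb (there mv∈) arrival≤t (map₁ there r)
    holdoverCause {c} {s} ŝ (cons {a = mv _ _ w} _ refl walk) shd∈
      with ∈-++⁻ (chain D T P S c ŝ (lastS c s)) shd∈
    ... | inj₁ shd∈chain with refl , ŝ≤t , t<last ← chainF-shd (suc T) c ŝ (lastS c s) shd∈chain =
      initial refl ŝ≤t (inj₂ (<-≤-trans t<last (lastS-≤ c s)))
    ... | inj₂ (there shd∈rest) with holdoverCause (lastS w (lastS c s + τ c w)) walk shd∈rest
    ...   | initial refl arrival≤t r = entered c s (here refl) arrival≤t (map₁ there r)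
    ...   | entered x tb mv∈ arrival≤t r = entered x tb (there mv∈) arrival≤t (map₁ there r)

    record Window (v : Fin n) (t : ℕ) (x : Fin n) (tb : ℕ) : Set where
      constructor window
      field
        t′       : ℕ
        t′≤T     : t′ ≤ T
        incoming : inNminus D T P S v t x t′ ≡ true
        t′<tb    : t′ < tb
        tb<next  : tb < nextS x t′

    AS-lands-at : ∀ {x û v t t″} → NS v t ≡ true → t ≤ û + τ x v → lastS v (û + τ x v) ≤ t →
                  AS x û v t″ ≡ true → t″ ≡ t
    AS-lands-at {x} {û} {v} {t} {t″} NS-t t≤ last≤t copy
      with m≤n⇒m<n∨m≡n
             (≤-trans (≤-lastS v _ (proj₂ (proj₂ (AS-arc x û v t″ copy))) (P2 x û v t″ copy)) last≤t)
    ... | inj₁ t″<t = ⊥-elim (P4 x û v t″ copy t NS-t t″<t t≤)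
    ... | inj₂ t″≡t = t″≡t

    window-via-AS : ∀ {v t x tb} → NS v t ≡ true → ValidT D T (mv x tb v) →
                    NS x (lastS x tb) ≡ true → lastS x tb < tb →
                    lastS v (lastS x tb + τ x v) ≤ t → t ≤ lastS x tb + τ x v → Window v t x tb
    window-via-AS {v} {t} {x} {tb} NS-t (x→v , tb+τ≤T) anchor early last≤t t≤
      with t″ , copy ← P3 x v (lastS x tb) x→v anchor
                          (≤-trans (+-monoˡ-≤ (τ x v) (lastS-≤ x tb)) tb+τ≤T)
      with refl ← AS-lands-at NS-t t≤ last≤t copy
      = window (lastS x tb) (≤-trans (lastS-≤ x tb) tb≤T) incoming early (lastS≤⇒<nextS x ≤-refl tb≤T)
      where
      tb≤T : tb ≤ T
      tb≤T = ≤-trans (m≤m+n tb (τ x v)) tb+τ≤T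
      incoming : inNminus D T P S v t x (lastS x tb) ≡ true
      incoming rewrite copy = ∨-zeroʳ _

    window-via-AT : ∀ {v t x tb} → t < T → arc x v ≡ true → tb + τ x v ≤ T →
                    lastS x tb + τ x v < t → t < tb + τ x v → Window v t x tb
    window-via-AT {v} {t} {x} {tb} t<T x→v tb+τ≤T last+τ<t t<tb+τ =
      window (t ∸ τ x v) (≤-trans (m∸n≤m t (τ x v)) (<⇒≤ t<T)) incoming t′<tb
        (lastS≤⇒<nextS x (<⇒≤ last<t′) (≤-trans (m≤m+n tb (τ x v)) tb+τ≤T))
      where
      t′+τ≡t : t ∸ τ x v + τ x v ≡ t
      t′+τ≡t = m∸n+n≡m (≤-trans (m≤n+m (τ x v) (lastS x tb)) (<⇒≤ last+τ<t))
      incoming : inNminus D T P S v t x (t ∸ τ x v) ≡ true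
      incoming rewrite x→v | fromWitness′ (t ∸ τ x v + τ x v ≟ t) t′+τ≡t = refl
      t′<tb : t ∸ τ x v < tb
      t′<tb = +-cancelʳ-< (τ x v) _ tb (subst (_< tb + τ x v) (sym t′+τ≡t) t<tb+τ)
      last<t′ : lastS x tb < t ∸ τ x v
      last<t′ = +-cancelʳ-< (τ x v) _ _ (subst (lastS x tb + τ x v <_) (sym t′+τ≡t) last+τ<t)

    entry-window : ∀ {v t x tb} → NS v t ≡ true → t < T → ValidT D T (mv x tb v) →
                   NS x (lastS x tb) ≡ true → lastS x tb < tb →
                   lastS v (lastS x tb + τ x v) ≤ t → t < tb + τ x v → Window v t x tb
    entry-window {v} {t} {x} {tb} NS-t t<T valid anchor early last≤t t<tb+τ
      with t ≤? lastS x tb + τ x v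
    ... | yes t≤ = window-via-AS NS-t valid anchor early last≤t t≤
    ... | no  t≰ = window-via-AT t<T (proj₁ valid) (proj₂ valid) (≰⇒> t≰) t<tb+τ

    module _ (Q : Fin K → List (TArc D T)) (feasible : Feasible D T P Q) (v : Fin n) (t : ℕ) where

      windowWidth : Fin n → ℕ → ℕ
      windowWidth x t′ = mS D T P S x t′ ∸ 1

      trajectory : ∀ k → Walk D T (src k , 0) (dst k , T) (Q k)
      trajectory k = proj₁ (proj₁ feasible k)

      load≤cap : ∀ x tb → ΣF (λ k → incT D T (Q k) (mv x tb v)) ≤ cap x v
      load≤cap x tb = ΣF-≤-if-positive _ _ λ k used →
        proj₁ (proj₂ feasible) x tb v (Walk-valid (trajectory k) (incT>0⇒∈ (Q k) _ used))

      windowLoad : Fin K → Fin n → ℕ → ℕ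
      windowLoad k x t′ = ΣF {windowWidth x t′} λ j → incT D T (Q k) (mv x (suc (t′ + toℕ j)) v)

      excess : Fin K → ℕ
      excess k = ΣF λ x → Σ≤ T λ t′ → if inNminus D T P S v t x t′ then windowLoad k x t′ else 0

      windowLoad≤ : ∀ x t′ → ΣF (λ k → windowLoad k x t′) ≤ cap x v * windowWidth x t′
      windowLoad≤ x t′ = begin
        ΣF (λ k → windowLoad k x t′)
          ≡⟨ ΣF-comm {K} {windowWidth x t′} (λ k j → incT D T (Q k) (mv x (suc (t′ + toℕ j)) v)) ⟩
        ΣF {windowWidth x t′} (λ j → ΣF (λ k → incT D T (Q k) (mv x (suc (t′ + toℕ j)) v)))
          ≤⟨ ΣF-mono {windowWidth x t′} (λ j → load≤cap x (suc (t′ + toℕ j))) ⟩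
        ΣF {windowWidth x t′} (λ _ → cap x v)
          ≡⟨ ΣF-const (cap x v) ⟩
        cap x v * windowWidth x t′ ∎
        where open ≤-Reasoning

      Σexcess≤U : ΣF excess ≤ U D T P S v t
      Σexcess≤U = ≤-trans (≤-reflexive (ΣF-comm (λ k x → Σ≤ T (slotLoad k x)))) (ΣF-mono λ x →
                    ≤-trans (≤-reflexive (ΣF-Σ≤ T (λ k → slotLoad k x))) (Σ≤-mono T (slotLoad≤ x)))
        where
        slotLoad : Fin K → Fin n → ℕ → ℕ
        slotLoad k x t′ = if inNminus D T P S v t x t′ then windowLoad k x t′ else 0
        slotLoad≤ : ∀ x t′ → ΣF (λ k → slotLoad k x t′)
                             ≤ (if inNminus D T P S v t x t′ then cap x v * (mS D T P S x t′ ∸ 1) else 0)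
        slotLoad≤ x t′ with inNminus D T P S v t x t′
        ... | true  = windowLoad≤ x t′
        ... | false = ≤-reflexive (ΣF-const {K} 0)

      excess-positive : ∀ k {x tb} → Window v t x tb → mv x tb v ∈ Q k → 1 ≤ excess k
      excess-positive k {x} {tb} (window t′ t′≤T incoming t′<tb tb<next) mv∈ = begin
        1                                              ≡⟨ incT-∈ mv∈ ⟨
        incT D T (Q k) (mv x tb v)                     ≡⟨ cong (λ s → incT D T (Q k) (mv x s v)) departs ⟨
        incT D T (Q k) (mv x (suc (t′ + toℕ j)) v)    ≤⟨ term≤ΣF _ j ⟩
        windowLoad k x t′                              ≡⟨ cong (λ b → if b then windowLoad k x t′ else 0) incoming ⟨
        (if inNminus D T P S v t x t′ then windowLoad k x t′ else 0)
                                                       ≤⟨ term≤Σ≤ T _ t′≤T ⟩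
        Σ≤ T (λ s → if inNminus D T P S v t x s then windowLoad k x s else 0)
                                                       ≤⟨ term≤ΣF _ x ⟩
        excess k                                       ∎
        where
        open ≤-Reasoning
        j<m : tb ∸ suc t′ < windowWidth x t′
        j<m = subst (tb ∸ suc t′ <_)
                (trans (cong (nextS x t′ ∸_) (+-comm 1 t′)) (sym (∸-+-assoc (nextS x t′) t′ 1)))
                (∸-monoˡ-< tb<next t′<tb)
        j : Fin (windowWidth x t′)
        j = fromℕ< j<m
        departs : suc (t′ + toℕ j) ≡ tb
        departs = trans (cong (λ i → suc (t′ + i)) (toℕ-fromℕ< j<m)) (m+[n∸m]≡n t′<tb)

      early-entry : ∀ k → any (entersEarly D T P S Q v) (Q k) ≡ true →
                    Σ (Fin n) λ u → Σ ℕ λ tb → mv u tb v ∈ Q k × lastS u tb < tb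
      early-entry k enters with any⇒∃∈ _ (Q k) enters
      ... | mv u tb w , a∈ , early
        with w≡v , last<tb ← ∧-true⁻ early
        with refl ← toWitness′ (w ≟F v) w≡v
        = u , tb , a∈ , <ᵇ-true⇒< last<tb

      x̂≤x̄+excess : SingleEntry D T P S Q v → NS v t ≡ true → t < T →
                    ∀ k → inK2 D T P S Q k v ≡ true → x̂ D T P S Q k v t ≤ x̄ D T P S Q k v t + excess k
      x̂≤x̄+excess single NS-t t<T k k∈K² with k∈Kv , enters ← ∧-true⁻ k∈K² =
        indicator≤ _ λ held → explain (cause held)
        where
        cause : any (isShd D T P S v t) (sTraj D T P S (src k) 0 (movements D T P S (Q k))) ≡ true →
                HoldoverCause v t (src k) 0 0 (Q k)
        cause held with y , y∈ , y-is ← any⇒∃∈ _ _ held =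
          holdoverCause 0 (trajectory k) (subst (_∈ _) (isShd⇒≡ y y-is) y∈)
        explain : HoldoverCause v t (src k) 0 0 (Q k) → 1 ≤ x̄ D T P S Q k v t + excess k
        explain (initial src≡v _ _) = contradiction src≡v (toWitnessFalse′ (src k ≟F v) (proj₁ (∧-true⁻ k∈Kv)))
        explain (entered _ _ _ _ (inj₁ hd∈)) = subst (λ z → 1 ≤ z + excess k) (sym (incT-∈ hd∈)) (m≤m+n 1 _)
        -- the arc entering v is the one that μ moves strictly earlier
        explain (entered x tb mv∈ last≤t (inj₂ t<arrival))
          with u , tb₀ , mv₀∈ , early ← early-entry k enters
          with refl , refl ← single k k∈Kv x tb u tb₀ mv∈ mv₀∈
          = ≤-trans (excess-positive k window′ mv∈) (m≤n+m _ _)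
          where
          window′ : Window v t x tb
          window′ = entry-window NS-t t<T (Walk-valid (trajectory k) mv∈)
                      (Walk-anchored (trajectory k) (proj₁ (P1 k)) mv∈) early last≤t t<arrival

      restricted-x̂≤ : SingleEntry D T P S Q v → NS v t ≡ true → t < T → ∀ k →
                      (if inK2 D T P S Q k v then x̂ D T P S Q k v t else 0)
                        ≤ (if inK2 D T P S Q k v then x̄ D T P S Q k v t else 0) + excess k
      restricted-x̂≤ single NS-t t<T k with inK2 D T P S Q k v in k∈K²
      ... | true  = x̂≤x̄+excess single NS-t t<T k k∈K²
      ... | false = z≤n

lemma6 : (D : Network) (T : ℕ) (P : Packets D) (S : PTEN D T P)
           (Q : Fin (Packets.K P) → List (TArc D T)) →
           Feasible D T P Q →
           (v : Fin (Network.n D)) (t : ℕ) →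
           PTEN.NS S v t ≡ true → t < T →
           SingleEntry D T P S Q v →
           ΣF (λ k → if inK2 D T P S Q k v then x̂ D T P S Q k v t else 0)
             ≤ ΣF (λ k → if inK2 D T P S Q k v then x̄ D T P S Q k v t else 0)
               + U D T P S v t
lemma6 D T P S Q feasible v t NS-t t<T single =
  ≤-trans (ΣF-mono (restricted-x̂≤ D T P S Q feasible v t single NS-t t<T))
    (≤-trans (≤-reflexive (ΣF-+ _ (excess D T P S Q feasible v t)))
      (+-monoʳ-≤ _ (Σexcess≤U D T P S Q feasible v t)))
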